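{- Let $n\ge 2$ and let $G_n=H_0H_1\cdots H_{n-1}$ be a spiro hexagonal chain with $n$ hexagons, with cut-vertices $c_1,\dots,c_{n-1}$ ($c_k$ the common vertex of $H_{k-1}$ and $H_k$), and let $G_{n-1}=H_0H_1\cdots H_{n-2}$. Let $c_n$ be any vertex of $H_{n-1}$ different from $c_{n-1}$ (when $n=1$, $c_1$ is any vertex of $H_0$). Then $$W(G_n)=W(G_{n-1})+5W(G_{n-1},c_{n-1})+45n-18,\qquad W(G_n,c_n)=W(G_{n-1},c_{n-1})+f(c_n),$$ with initial values $W(G_1)=27$ and $W(G_1,c_1)=f(c_1)=9$, where $$f(c_n)=\begin{cases}5(n-1)+9,& c_n \text{ is } o_{n-1},\\ 10(n-1)+9,& c_n\text{ is } m_{n-1},\\ 15(n-1)+9,& c_n\text{ is } p_{n-1}.\end{cases}$$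
   Context: All graphs are simple and connected; $d(u,v)$ is the shortest-path distance. The Wiener index is $W(G)=\sum_{\{u,v\}\subseteq V(G)} d(u,v)$, and for a vertex $v$, $W(G,v)=\sum_{u\in V(G)} d(u,v)$. A spiro hexagonal chain with $n$ hexagons is a graph $G_n=H_0H_1\cdots H_{n-1}$ that is the union of hexagons (6-cycles) $H_0,\dots,H_{n-1}$ such that for $1\le k\le n-1$, $H_{k-1}$ and $H_k$ share exactly one vertex $c_k$ (the cut-vertex), the $c_k$ are distinct, and $H_i,H_j$ are disjoint when $|i-j|\ge 2$; $G_k=H_0\cdots H_{k-1}$ denotes the subchain of the first $k$ hexagons. For $k\ge 1$, a vertex $v$ of $H_k$ is called an ortho-, meta- or para-vertex of $H_k$, written $o_k$, $m_k$, $p_k$, if its distance from $c_k$ is $1$, $2$ or $3$ respectively. -}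

module Defs where

open import Data.Nat using (ℕ; zero; suc; _+_; _*_; _≡ᵇ_; _<ᵇ_)
open import Data.Bool using (Bool; true; false; _∧_; _∨_; if_then_else_)
open import Data.Fin using (Fin; zero; suc; toℕ)
open import Data.List using (List; upTo; map; allFin)
open import Data.Nat.ListAction using (sum)
open import Data.Bool.ListAction using (any)

record Graph : Set where
  field
    size : ℕ                 -- vertices are 0 … size-1
    adj  : ℕ → ℕ → Bool

open Graph public

reach : Graph → ℕ → ℕ → ℕ → Bool
reach G zero    u v = u ≡ᵇ v
reach G (suc t) u v =
  reach G t u v ∨ any (λ w → reach G t u w ∧ adj G w v) (upTo (size G))

distSearch : Graph → ℕ → ℕ → ℕ → ℕ → ℕ
distSearch G t zero       u v = t
distSearch G t (suc fuel) u v =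
  if reach G t u v then t else distSearch G (suc t) fuel u v

-- shortest-path distance d(u,v) (for a connected graph the search
-- always succeeds, since every distance is < size)
dist : Graph → ℕ → ℕ → ℕ
dist G u v = distSearch G 0 (size G) u v

wiener : Graph → ℕ
wiener G = sum (map (λ u → sum (map (λ v → dist G u v) (upTo u))) (upTo (size G)))

wienerAt : Graph → ℕ → ℕ
wienerAt G v = sum (map (λ u → dist G u v) (upTo (size G)))

-- A chain is described by an attachment sequence s : ℕ → Fin 6.
-- Each hexagon H_k has local positions 0,…,5 around the cycle
-- (position j adjacent to j±1 mod 6).  For k ≥ 1, local position 0 of
-- H_k is the cut-vertex c_k.  The next cut-vertex c_{k+1} is the
-- vertex of H_k at local position s k.  (For k ≥ 1 one requires
-- s k ≠ 0, i.e. c_{k+1} ≠ c_k.)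
-- Global vertex numbering: H_0 uses 0…5; H_k (k ≥ 1) uses c_k and the
-- new vertices 5k+1 … 5k+5.  G_n has 5n+1 vertices.

cut : (ℕ → Fin 6) → ℕ → ℕ
cut s zero          = zero   -- unused
cut s (suc zero)    = toℕ (s zero)
cut s (suc (suc k)) = pick (s (suc k)) (cut s (suc k))
  where
  -- position of c_{k+2} in H_{k+1}: position 0 is c_{k+1} itself
  pick : Fin 6 → ℕ → ℕ
  pick zero    c = c
  pick (suc j) c = 5 * suc k + suc (toℕ j)

glob : (ℕ → Fin 6) → ℕ → Fin 6 → ℕ
glob s zero    j       = toℕ j
glob s (suc k) zero    = cut s (suc k)
glob s (suc k) (suc j) = 5 * suc k + suc (toℕ j)

nextPos : Fin 6 → Fin 6
nextPos zero                               = suc zero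
nextPos (suc zero)                         = suc (suc zero)
nextPos (suc (suc zero))                   = suc (suc (suc zero))
nextPos (suc (suc (suc zero)))             = suc (suc (suc (suc zero)))
nextPos (suc (suc (suc (suc zero))))       = suc (suc (suc (suc (suc zero))))
nextPos (suc (suc (suc (suc (suc zero))))) = zero

hexAdj : (ℕ → Fin 6) → ℕ → ℕ → ℕ → Bool
hexAdj s k u v = any (λ j →
    ((glob s k j ≡ᵇ u) ∧ (glob s k (nextPos j) ≡ᵇ v))
  ∨ ((glob s k j ≡ᵇ v) ∧ (glob s k (nextPos j) ≡ᵇ u)))
  (allFin 6)

spiroChain : (ℕ → Fin 6) → ℕ → Graph
spiroChain s n = record
  { size = 5 * n + 1
  ; adj  = λ u v → any (λ k → hexAdj s k u v) (upTo n)
  }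

-- G_{m+1} is G_m with the hexagon H_m glued at the single vertex c = glob s m 0.  A shortest
-- path between two vertices of G_m stays in G_m, one between two new vertices stays in H_m,
-- and any other one passes through c; so d_{G_{m+1}} is an explicit function D′ of d_{G_m}
-- and of the cyclic distance on C₆.  That D′ is the shortest-path distance is checked by a
-- local characterisation (it vanishes exactly at the source, is 1-Lipschitz along edges, and
-- every positive value is attained one step after a smaller one), carried along by
-- induction on m.  Summing D′ over the 5m + 6 vertices: each new vertex at position p
-- contributes W(G_m, c) + (5m + 1)·d(p, 0) plus distances inside the hexagon, and
-- Σ_p d(p, q) = 9 for every vertex q of C₆.  This gives both recurrences, and their
-- instances at m = 0 are the initial values.
module Submission where

open import Defs
open import Data.Nat using (ℕ; zero; suc; _+_; _*_; _∸_; _≤_; _<_)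
open import Data.Fin using (Fin; zero)
open import Data.Product using (_×_)
open import Relation.Binary.PropositionalEquality using (_≡_; _≢_)

open import Algebra.Properties.CommutativeSemigroup using (interchange)
open import Data.Bool using (Bool; true; false; T; _∧_; _∨_; if_then_else_)
open import Data.Bool.ListAction using (any)
open import Data.Bool.Properties using (T-∧; T-∨; T-≡; ∨-zeroʳ)
open import Data.Empty using (⊥-elim)
open import Data.Fin as Fin using (suc; toℕ; fromℕ<)
open import Data.Fin.Properties using (all?; any?; toℕ<n; toℕ-fromℕ<)
open import Data.List using (List; []; _∷_; _++_; upTo; applyUpTo; map; length; allFin)
open import Data.List.Membership.Propositional using (find; lose)
open import Data.List.Membership.Propositional.Properties using (∈-upTo⁺; ∈-upTo⁻; ∈-allFin)
open import Data.List.Properties using (map-cong-local; map-upTo; length-upTo)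
open import Data.List.Relation.Unary.All.Properties using (applyUpTo⁺₁)
open import Data.List.Relation.Unary.Any.Properties using (any⁺; any⁻)
open import Data.Nat using (_≡ᵇ_; z≤n; s≤s; s≤s⁻¹; _⊓_; ∣_-_∣; _≟_; _≤?_; _<?_)
open import Data.Nat.ListAction using (sum)
open import Data.Nat.ListAction.Properties using (sum-++)
open import Data.Nat.Properties
open import Data.Nat.Tactic.RingSolver using (solve-∀)
open import Data.Product using (∃-syntax; _,_)
open import Data.Sum using (_⊎_; inj₁; inj₂)
open import Function using (_∘_; id; case_of_; Equivalence)
open import Relation.Binary.PropositionalEquality
  using (refl; sym; trans; cong; cong₂; subst; subst₂; module ≡-Reasoning)
open import Relation.Nullary using (Dec; yes; no; does)
open import Relation.Nullary.Decidable
  using (dec-true; dec-false; toWitness; _⊎-dec_; _×-dec_; _→-dec_)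

-- Distances in a finite graph

≡ᵇ-true : ∀ n → (n ≡ᵇ n) ≡ true
≡ᵇ-true n = Equivalence.to T-≡ (≡⇒≡ᵇ n n refl)

any-upTo⁻ : ∀ (P : ℕ → Bool) n → T (any P (upTo n)) → ∃[ i ] i < n × T (P i)
any-upTo⁻ P n h with find (any⁻ P (upTo n) h)
... | i , i∈ , Pi = i , ∈-upTo⁻ i∈ , Pi

any-upTo⁺ : ∀ (P : ℕ → Bool) {n i} → i < n → T (P i) → T (any P (upTo n))
any-upTo⁺ P i<n Pi = any⁺ P (lose (∈-upTo⁺ i<n) Pi)

record IsDistanceFrom (G : Graph) (u : ℕ) (f : ℕ → ℕ) : Set where
  field
    source      : f u ≡ 0
    zero⇒source : ∀ {v} → v < size G → f v ≡ 0 → u ≡ v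
    predecessor : ∀ {v d} → v < size G → f v ≡ suc d →
                  ∃[ w ] w < size G × T (adj G w v) × f w ≡ d
    lipschitz   : ∀ {w v} → w < size G → v < size G → T (adj G w v) → f v ≤ suc (f w)

module _ {G : Graph} {u : ℕ} {f : ℕ → ℕ} (isDist : IsDistanceFrom G u f) where
  open IsDistanceFrom isDist

  reach⇒≤ : ∀ t {v} → v < size G → T (reach G t u v) → f v ≤ t
  reach⇒≤ zero    v< h with ≡ᵇ⇒≡ u _ h
  ... | refl = ≤-reflexive source
  reach⇒≤ (suc t) v< h with Equivalence.to T-∨ h
  ... | inj₁ h′ = m≤n⇒m≤1+n (reach⇒≤ t v< h′)
  ... | inj₂ h′ with any-upTo⁻ _ (size G) h′
  ... | w , w< , hw with Equivalence.to T-∧ hw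
  ... | reach-w , w~v = ≤-trans (lipschitz w< v< w~v) (s≤s (reach⇒≤ t w< reach-w))

  ≤⇒reach : ∀ t {v} → v < size G → f v ≤ t → T (reach G t u v)
  ≤⇒reach zero    v< fv≤0 = ≡⇒≡ᵇ u _ (zero⇒source v< (n≤0⇒n≡0 fv≤0))
  ≤⇒reach (suc t) v< fv≤ with m≤n⇒m<n∨m≡n fv≤
  ... | inj₁ (s≤s fv≤t) = Equivalence.from T-∨ (inj₁ (≤⇒reach t v< fv≤t))
  ... | inj₂ fv≡ with predecessor v< fv≡
  ... | w , w< , w~v , fw≡t = Equivalence.from T-∨ (inj₂ (any-upTo⁺ _ w<
          (Equivalence.from T-∧ (≤⇒reach t w< (≤-reflexive fw≡t) , w~v))))

  distSearch≡ : ∀ fuel t {v} → v < size G → t ≤ f v → f v ≤ t + fuel →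
                distSearch G t fuel u v ≡ f v
  distSearch≡ zero       t v< t≤ ≤t = ≤-antisym t≤ (≤-trans ≤t (≤-reflexive (+-identityʳ t)))
  distSearch≡ (suc fuel) t {v} v< t≤ ≤t with reach G t u v in found
  ... | true  = ≤-antisym t≤ (reach⇒≤ t v< (Equivalence.from T-≡ found))
  ... | false = distSearch≡ fuel (suc t) v< t< (≤-trans ≤t (≤-reflexive (+-suc t fuel)))
    where
    t< : t < f v
    t< with m≤n⇒m<n∨m≡n t≤
    ... | inj₁ t<fv = t<fv
    ... | inj₂ refl with ≤⇒reach t v< ≤-refl
    ... | r rewrite found = ⊥-elim r

  -- The bound is needed because dist only searches up to distance size G.
  dist≡ : ∀ {v} → v < size G → f v ≤ size G → dist G u v ≡ f v
  dist≡ v< bound = distSearch≡ (size G) 0 v< z≤n bound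

dist≤size : ∀ G u v → dist G u v ≤ size G
dist≤size G u v = go (size G) 0
  where
  go : ∀ fuel t → distSearch G t fuel u v ≤ t + fuel
  go zero       t = ≤-reflexive (sym (+-identityʳ t))
  go (suc fuel) t with reach G t u v
  ... | true  = m≤m+n t (suc fuel)
  ... | false = ≤-trans (go fuel (suc t)) (≤-reflexive (sym (+-suc t fuel)))

IsDistanceFrom-cong : ∀ {G u f g} → u < size G → (∀ {v} → v < size G → f v ≡ g v) →
                      IsDistanceFrom G u f → IsDistanceFrom G u g
IsDistanceFrom-cong {G} {u} {f} {g} u< f≗g isDist = record
  { source      = trans (sym (f≗g u<)) source
  ; zero⇒source = λ v< gv≡0 → zero⇒source v< (trans (f≗g v<) gv≡0)
  ; predecessor = λ v< gv≡ → lift (predecessor v< (trans (f≗g v<) gv≡))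
  ; lipschitz   = λ w< v< w~v → subst₂ (λ a b → a ≤ suc b) (f≗g v<) (f≗g w<) (lipschitz w< v< w~v)
  }
  where
  open IsDistanceFrom isDist
  lift : ∀ {v d} → ∃[ w ] w < size G × T (adj G w v) × f w ≡ d →
         ∃[ w ] w < size G × T (adj G w v) × g w ≡ d
  lift (w , w< , w~v , fw≡) = w , w< , w~v , trans (sym (f≗g w<)) fw≡

record DistanceLaws (G : Graph) : Set where
  field
    isDistanceFrom : ∀ {u} → u < size G → IsDistanceFrom G u (dist G u)
    dist-sym       : ∀ {u v} → u < size G → v < size G → dist G u v ≡ dist G v u

sumUpTo : ℕ → (ℕ → ℕ) → ℕ
sumUpTo n f = sum (map f (upTo n))

module _ {A : Set} where

  sum-map-+ : ∀ (f g : A → ℕ) xs →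
              sum (map (λ x → f x + g x) xs) ≡ sum (map f xs) + sum (map g xs)
  sum-map-+ f g []       = refl
  sum-map-+ f g (x ∷ xs) = begin
    f x + g x + sum (map (λ x → f x + g x) xs)  ≡⟨ cong (f x + g x +_) (sum-map-+ f g xs) ⟩
    f x + g x + (sum (map f xs) + sum (map g xs)) ≡⟨ interchange +-commutativeSemigroup (f x) (g x) _ _ ⟩
    f x + sum (map f xs) + (g x + sum (map g xs)) ∎
    where open ≡-Reasoning

  sum-map-*ˡ : ∀ k (f : A → ℕ) xs → sum (map (λ x → k * f x) xs) ≡ k * sum (map f xs)
  sum-map-*ˡ k f []       = sym (*-zeroʳ k)
  sum-map-*ˡ k f (x ∷ xs) = trans (cong (k * f x +_) (sum-map-*ˡ k f xs)) (sym (*-distribˡ-+ k (f x) _))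

  sum-map-const : ∀ k (xs : List A) → sum (map (λ _ → k) xs) ≡ length xs * k
  sum-map-const k []       = refl
  sum-map-const k (x ∷ xs) = cong (k +_) (sum-map-const k xs)

sumUpTo-const : ∀ n k → sumUpTo n (λ _ → k) ≡ n * k
sumUpTo-const n k = trans (sum-map-const k (upTo n)) (cong (_* k) (length-upTo n))

sumUpTo-cong : ∀ n {f g : ℕ → ℕ} → (∀ {i} → i < n → f i ≡ g i) → sumUpTo n f ≡ sumUpTo n g
sumUpTo-cong n f≗g = cong sum (map-cong-local (applyUpTo⁺₁ id n f≗g))

applyUpTo-+ : ∀ {A : Set} (f : ℕ → A) m n →
              applyUpTo f (m + n) ≡ applyUpTo f m ++ applyUpTo (f ∘ (m +_)) n
applyUpTo-+ f zero    n = refl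
applyUpTo-+ f (suc m) n = cong (f 0 ∷_) (applyUpTo-+ (f ∘ suc) m n)

sumUpTo-+ : ∀ m n f → sumUpTo (m + n) f ≡ sumUpTo m f + sumUpTo n (λ i → f (m + i))
sumUpTo-+ m n f = begin
  sumUpTo (m + n) f
    ≡⟨ cong sum (map-upTo f (m + n)) ⟩
  sum (applyUpTo f (m + n))
    ≡⟨ cong sum (applyUpTo-+ f m n) ⟩
  sum (applyUpTo f m ++ applyUpTo (f ∘ (m +_)) n)
    ≡⟨ sum-++ (applyUpTo f m) _ ⟩
  sum (applyUpTo f m) + sum (applyUpTo (f ∘ (m +_)) n)
    ≡⟨ cong₂ _+_ (cong sum (map-upTo f m)) (cong sum (map-upTo (f ∘ (m +_)) n)) ⟨
  sumUpTo m f + sumUpTo n (λ i → f (m + i))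
    ∎
  where open ≡-Reasoning

-- The hexagon C₆

Adjacent : Fin 6 → Fin 6 → Set
Adjacent j k = k ≡ nextPos j ⊎ j ≡ nextPos k

adjacent? : ∀ j k → Dec (Adjacent j k)
adjacent? j k = (k Fin.≟ nextPos j) ⊎-dec (j Fin.≟ nextPos k)

hexDist : Fin 6 → Fin 6 → ℕ
hexDist j k = ∣ toℕ j - toℕ k ∣ ⊓ (6 ∸ ∣ toℕ j - toℕ k ∣)

toPosition : ℕ → Fin 6
toPosition p with p <? 6
... | yes p<6 = fromℕ< p<6
... | no  _   = zero

toPosition-toℕ : ∀ k → toPosition (toℕ k) ≡ k
toPosition-toℕ = toWitness {a? = all? λ k → toPosition (toℕ k) Fin.≟ k} _

hexDist-sym : ∀ j k → hexDist j k ≡ hexDist k j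
hexDist-sym = toWitness {a? = all? λ j → all? λ k → hexDist j k ≟ hexDist k j} _

hexDist-self : ∀ k → hexDist k k ≡ 0
hexDist-self = toWitness {a? = all? λ k → hexDist k k ≟ 0} _

hexDist≡0⇒≡ : ∀ j k → hexDist j k ≡ 0 → j ≡ k
hexDist≡0⇒≡ = toWitness {a? = all? λ j → all? λ k → hexDist j k ≟ 0 →-dec j Fin.≟ k} _

hexDist≤3 : ∀ j k → hexDist j k ≤ 3
hexDist≤3 = toWitness {a? = all? λ j → all? λ k → hexDist j k ≤? 3} _

hexDist-adjacent : ∀ p {j k} → Adjacent j k → hexDist p k ≤ suc (hexDist p j)
hexDist-adjacent p {j} {k} = toWitness {a? = all? λ p → all? λ j → all? λ k →
  adjacent? j k →-dec hexDist p k ≤? suc (hexDist p j)} _ p j k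

hexDist-predecessor : ∀ p k → p ≢ k → ∃[ j ] Adjacent j k × suc (hexDist p j) ≡ hexDist p k
hexDist-predecessor p k p≢k with toWitness {a? = all? λ p → all? λ k →
  p Fin.≟ k ⊎-dec any? λ j → adjacent? j k ×-dec suc (hexDist p j) ≟ hexDist p k} _ p k
... | inj₁ p≡k  = ⊥-elim (p≢k p≡k)
... | inj₂ pred = pred

wienerAt-hexagon : ∀ q → hexDist zero q + sumUpTo 5 (λ i → hexDist (toPosition (suc i)) q) ≡ 9
wienerAt-hexagon = toWitness {a? = all? λ q →
  hexDist zero q + sumUpTo 5 (λ i → hexDist (toPosition (suc i)) q) ≟ 9} _

module _ (s : ℕ → Fin 6) where

  cut≡glob : ∀ k → cut s (suc k) ≡ glob s k (s k)
  cut≡glob zero    = refl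
  cut≡glob (suc k) with s (suc k)
  ... | zero  = refl
  ... | suc _ = refl

  glob-suc : ∀ m j → glob s m (suc j) ≡ 5 * m + suc (toℕ j)
  glob-suc zero    j = refl
  glob-suc (suc m) j = refl

  size-suc : ∀ m → size (spiroChain s (suc m)) ≡ size (spiroChain s m) + 5
  size-suc m = identity m
    where
    identity : ∀ m → 5 * suc m + 1 ≡ 5 * m + 1 + 5
    identity = solve-∀

  size-mono : ∀ {m n} → m ≤ n → size (spiroChain s m) ≤ size (spiroChain s n)
  size-mono m≤n = +-monoˡ-≤ 1 (*-monoʳ-≤ 5 m≤n)

  new<size : ∀ m {i} → i < 5 → 5 * m + suc i < size (spiroChain s (suc m))
  new<size m i<5 = ≤-trans (+-monoʳ-< (5 * m) (s≤s i<5))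
                           (≤-reflexive (trans (sym (+-assoc (5 * m) 1 5)) (sym (size-suc m))))

  glob<size : ∀ {k n} → k < n → ∀ j → glob s k j < size (spiroChain s n)
  glob<size {k} k<n j = <-≤-trans (glob< k j) (size-mono k<n)
    where
    glob< : ∀ k j → glob s k j < size (spiroChain s (suc k))
    glob< zero    j       = toℕ<n j
    glob< (suc k) zero rewrite cut≡glob k = <-≤-trans (glob< k (s k)) (size-mono (n≤1+n (suc k)))
    glob< (suc k) (suc j) = new<size (suc k) (toℕ<n j)

  adj-spiroChain⁻ : ∀ {n w v} → T (adj (spiroChain s n) w v) → ∃[ k ] k < n × T (hexAdj s k w v)
  adj-spiroChain⁻ {n} = any-upTo⁻ _ n

  adj-spiroChain⁺ : ∀ {n k w v} → k < n → T (hexAdj s k w v) → T (adj (spiroChain s n) w v)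
  adj-spiroChain⁺ = any-upTo⁺ _

  edgeAt : ℕ → ℕ → ℕ → Fin 6 → Bool
  edgeAt k u v j = ((glob s k j ≡ᵇ u) ∧ (glob s k (nextPos j) ≡ᵇ v))
                 ∨ ((glob s k j ≡ᵇ v) ∧ (glob s k (nextPos j) ≡ᵇ u))

  hexAdj⁻ : ∀ {k w v} → T (hexAdj s k w v) →
            ∃[ i ] ∃[ j ] Adjacent i j × w ≡ glob s k i × v ≡ glob s k j
  hexAdj⁻ {k} {w} {v} h with find (any⁻ (edgeAt k w v) (allFin 6) h)
  ... | i , _ , edge with Equivalence.to T-∨ edge
  ... | inj₁ forward  with Equivalence.to T-∧ forward
  ...   | i≡w , i⁺≡v = i , nextPos i , inj₁ refl , sym (≡ᵇ⇒≡ _ _ i≡w) , sym (≡ᵇ⇒≡ _ _ i⁺≡v)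
  hexAdj⁻ h | i , _ , _ | inj₂ backward with Equivalence.to T-∧ backward
  ...   | i≡v , i⁺≡w = nextPos i , i , inj₂ refl , sym (≡ᵇ⇒≡ _ _ i⁺≡w) , sym (≡ᵇ⇒≡ _ _ i≡v)

  hexAdj⁺ : ∀ {k i j} → Adjacent i j → T (hexAdj s k (glob s k i) (glob s k j))
  hexAdj⁺ {k} {i} (inj₁ refl) =
    any⁺ (edgeAt k (glob s k i) (glob s k (nextPos i))) (lose (∈-allFin i) forward)
    where
    forward : T (edgeAt k (glob s k i) (glob s k (nextPos i)) i)
    forward rewrite ≡ᵇ-true (glob s k i) | ≡ᵇ-true (glob s k (nextPos i)) = _
  hexAdj⁺ {k} {j = j} (inj₂ refl) =
    any⁺ (edgeAt k (glob s k (nextPos j)) (glob s k j)) (lose (∈-allFin j) backward)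
    where
    backward : T (edgeAt k (glob s k (nextPos j)) (glob s k j) j)
    backward rewrite ≡ᵇ-true (glob s k j) | ≡ᵇ-true (glob s k (nextPos j))
                   | ∨-zeroʳ ((glob s k j ≡ᵇ glob s k (nextPos j)) ∧ (glob s k (nextPos j) ≡ᵇ glob s k j)) = _

  adj⇒<size : ∀ {n w v} → T (adj (spiroChain s n) w v) →
              w < size (spiroChain s n) × v < size (spiroChain s n)
  adj⇒<size {n} {w} {v} a with adj-spiroChain⁻ {n} {w} {v} a
  ... | k , k<n , h with hexAdj⁻ {k} {w} {v} h
  ... | i , j , _ , refl , refl = glob<size k<n i , glob<size k<n j

  attachment<size : ∀ m → glob s m zero < size (spiroChain s m)
  attachment<size zero    = s≤s z≤n
  attachment<size (suc m) rewrite cut≡glob m = glob<size ≤-refl (s m)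

  adj-spiroChain-suc⁻ : ∀ {m w v} → T (adj (spiroChain s (suc m)) w v) →
                        T (adj (spiroChain s m) w v) ⊎ T (hexAdj s m w v)
  adj-spiroChain-suc⁻ {m} {w} {v} a with adj-spiroChain⁻ {suc m} {w} {v} a
  ... | k , k<1+m , h with m≤n⇒m<n∨m≡n (s≤s⁻¹ k<1+m)
  ... | inj₁ k<m  = inj₁ (adj-spiroChain⁺ k<m h)
  ... | inj₂ refl = inj₂ h

  adj-spiroChain-mono : ∀ {m n w v} → m ≤ n →
                        T (adj (spiroChain s m) w v) → T (adj (spiroChain s n) w v)
  adj-spiroChain-mono {m} {n} {w} {v} m≤n a with adj-spiroChain⁻ {m} {w} {v} a
  ... | k , k<m , h = adj-spiroChain⁺ (<-≤-trans k<m m≤n) h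

-- Gluing H_m onto G_m

module Gluing (s : ℕ → Fin 6) (m : ℕ) (laws : DistanceLaws (spiroChain s m)) where
  open DistanceLaws laws

  G G′ : Graph
  G  = spiroChain s m
  G′ = spiroChain s (suc m)

  N : ℕ
  N = 5 * m

  H : Fin 6 → ℕ
  H = glob s m

  c : ℕ
  c = H zero

  D : ℕ → ℕ → ℕ
  D = dist G

  isOld : ℕ → Bool
  isOld v = does (v <? size G)

  position : ℕ → Fin 6
  position v = if isOld v then zero else toPosition (v ∸ N)

  toCut : ℕ → ℕ
  toCut v = if isOld v then D v c else 0

  -- Unless both ends lie in G, a shortest path in G′ passes through c and runs around H_m.
  D′ : ℕ → ℕ → ℕ
  D′ u v = if isOld u ∧ isOld v then D u v
           else toCut u + hexDist (position u) (position v) + toCut v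

  c< : c < size G
  c< = attachment<size s m

  +≤size′ : ∀ {a h} → a ≤ size G → h ≤ 3 → a + h ≤ size G′
  +≤size′ a≤ h≤3 =
    ≤-trans (+-mono-≤ a≤ (≤-trans h≤3 (m≤m+n 3 2))) (≤-reflexive (sym (size-suc s m)))

  old<′ : ∀ {v} → v < size G → v < size G′
  old<′ v< = <-≤-trans v< (size-mono s (n≤1+n m))

  H<′ : ∀ k → H k < size G′
  H<′ = glob<size s (n<1+n m)

  isOld-old : ∀ {v} → v < size G → isOld v ≡ true
  isOld-old {v} = dec-true (v <? size G)

  isOld-new : ∀ i → isOld (N + suc i) ≡ false
  isOld-new i = dec-false (N + suc i <? size G) λ lt → case +-cancelˡ-< N (suc i) 1 lt of λ { (s≤s ()) }

  module From {u} (u< : u < size G) = IsDistanceFrom (isDistanceFrom u<)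
  module FromCut = IsDistanceFrom (isDistanceFrom c<)

  toCut-step : ∀ {v} → v < size G →
               c ≡ v ⊎ ∃[ w ] w < size G × T (adj G w v) × suc (D w c) ≡ D v c
  toCut-step {v} v< with D v c in Dvc≡
  ... | zero  = inj₁ (FromCut.zero⇒source v< (trans (dist-sym c< v<) Dvc≡))
  ... | suc q with FromCut.predecessor v< (trans (dist-sym c< v<) Dvc≡)
  ...   | w , w< , w~v , Dcw≡ = inj₂ (w , w< , w~v , cong suc (trans (dist-sym w< c<) Dcw≡))

  toCut-lipschitz : ∀ {w v} → w < size G → v < size G → T (adj G w v) → D v c ≤ suc (D w c)
  toCut-lipschitz w< v< w~v
    rewrite dist-sym v< c< | dist-sym w< c< = FromCut.lipschitz w< v< w~v

  D′-old-old : ∀ {u v} → u < size G → v < size G → D′ u v ≡ D u v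
  D′-old-old u< v< rewrite isOld-old u< | isOld-old v< = refl

  D′-old-new : ∀ {u} i → u < size G → D′ u (N + suc i) ≡ D u c + hexDist zero (toPosition (suc i))
  D′-old-new i u< rewrite isOld-old u< | isOld-new i | m+n∸m≡n N (suc i) = +-identityʳ _

  D′-new-old : ∀ {v} i → v < size G → D′ (N + suc i) v ≡ hexDist (toPosition (suc i)) zero + D v c
  D′-new-old i v< rewrite isOld-old v< | isOld-new i | m+n∸m≡n N (suc i) = refl

  D′-new-new : ∀ i j → D′ (N + suc i) (N + suc j) ≡ hexDist (toPosition (suc i)) (toPosition (suc j))
  D′-new-new i j rewrite isOld-new i | isOld-new j | m+n∸m≡n N (suc i) | m+n∸m≡n N (suc j) =
    +-identityʳ _

  H-suc : ∀ (i : Fin 5) → H (suc i) ≡ N + suc (toℕ i)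
  H-suc = glob-suc s m

  toPosition-suc : ∀ (i : Fin 5) → toPosition (suc (toℕ i)) ≡ suc i
  toPosition-suc i = toPosition-toℕ (suc i)

  D′-old-H : ∀ {u} → u < size G → ∀ k → D′ u (H k) ≡ D u c + hexDist zero k
  D′-old-H u< zero    = trans (D′-old-old u< c<) (sym (+-identityʳ _))
  D′-old-H u< (suc j) rewrite H-suc j | D′-old-new (toℕ j) u< | toPosition-suc j = refl

  D′-hex-old : ∀ {v} (i : Fin 5) → v < size G → D′ (H (suc i)) v ≡ hexDist (suc i) zero + D v c
  D′-hex-old i v< rewrite H-suc i | D′-new-old (toℕ i) v< | toPosition-suc i = refl

  D′-new-H : ∀ i k → D′ (N + suc i) (H k) ≡ hexDist (toPosition (suc i)) k
  D′-new-H i zero    rewrite D′-new-old i c< | FromCut.source = +-identityʳ _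
  D′-new-H i (suc j) rewrite H-suc j | D′-new-new i (toℕ j) | toPosition-suc j = refl

  D′-hex-H : ∀ (i : Fin 5) k → D′ (H (suc i)) (H k) ≡ hexDist (suc i) k
  D′-hex-H i k rewrite H-suc i | D′-new-H (toℕ i) k | toPosition-suc i = refl

  data Vertex : ℕ → Set where
    old : ∀ {v} → v < size G → Vertex v
    new : (i : Fin 5) → Vertex (H (suc i))

  vertex : ∀ {v} → v < size G′ → Vertex v
  vertex {v} v<′ with v <? size G
  ... | yes v< = old v<
  ... | no  v≮ = subst Vertex H[1+i]≡v (new (fromℕ< i<5))
    where
    i : ℕ
    i = v ∸ size G
    v≡ : size G + i ≡ v
    v≡ = m+[n∸m]≡n (≮⇒≥ v≮)
    i<5 : i < 5
    i<5 = +-cancelˡ-< (size G) i 5 (subst₂ _<_ (sym v≡) (size-suc s m) v<′)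
    H[1+i]≡v : H (suc (fromℕ< i<5)) ≡ v
    H[1+i]≡v = begin
      H (suc (fromℕ< i<5))          ≡⟨ H-suc (fromℕ< i<5) ⟩
      N + suc (toℕ (fromℕ< i<5))    ≡⟨ cong (λ j → N + suc j) (toℕ-fromℕ< i<5) ⟩
      N + suc i                     ≡⟨ sym (+-assoc N 1 i) ⟩
      size G + i                    ≡⟨ v≡ ⟩
      v                             ∎
      where open ≡-Reasoning

  hexagon-predecessor : ∀ {u a p k d} → (∀ j → D′ u (H j) ≡ a + hexDist p j) → p ≢ k →
                        D′ u (H k) ≡ suc d → ∃[ w ] w < size G′ × T (adj G′ w (H k)) × D′ u w ≡ d
  hexagon-predecessor {u} {a} {p} {k} {d} D′≡ p≢k e with hexDist-predecessor p k p≢k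
  ... | j , j~k , closer = H j , H<′ j , adj-spiroChain⁺ s (n<1+n m) (hexAdj⁺ s {k = m} j~k) ,
        suc-injective (begin
          suc (D′ u (H j))         ≡⟨ cong suc (D′≡ j) ⟩
          suc (a + hexDist p j)    ≡⟨ sym (+-suc a _) ⟩
          a + suc (hexDist p j)    ≡⟨ cong (a +_) closer ⟩
          a + hexDist p k          ≡⟨ sym (D′≡ k) ⟩
          D′ u (H k)               ≡⟨ e ⟩
          suc d                    ∎)
    where open ≡-Reasoning

  hexagon-lipschitz : ∀ {u a p j k} → (∀ j → D′ u (H j) ≡ a + hexDist p j) → Adjacent j k →
                      D′ u (H k) ≤ suc (D′ u (H j))
  hexagon-lipschitz {u} {a} {p} {j} {k} D′≡ j~k rewrite D′≡ j | D′≡ k =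
    ≤-trans (+-monoʳ-≤ a (hexDist-adjacent p j~k)) (≤-reflexive (+-suc a _))

  D′-source : ∀ {u} → u < size G′ → D′ u u ≡ 0
  D′-source u<′ with vertex u<′
  ... | old u< = trans (D′-old-old u< u<) (From.source u<)
  ... | new i  = trans (D′-hex-H i (suc i)) (hexDist-self (suc i))

  D′-zero⇒source : ∀ {u v} → u < size G′ → v < size G′ → D′ u v ≡ 0 → u ≡ v
  D′-zero⇒source u<′ v<′ e with vertex u<′ | vertex v<′
  ... | old u< | old v< = From.zero⇒source u< v< (trans (sym (D′-old-old u< v<)) e)
  ... | old u< | new j
    with hexDist≡0⇒≡ zero (suc j) (m+n≡0⇒n≡0 (D _ c) (trans (sym (D′-old-H u< (suc j))) e))
  ...   | ()
  D′-zero⇒source u<′ v<′ e | new i | old v<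
    with hexDist≡0⇒≡ (suc i) zero (m+n≡0⇒m≡0 _ (trans (sym (D′-hex-old i v<)) e))
  ...   | ()
  D′-zero⇒source u<′ v<′ e | new i | new j =
    cong H (hexDist≡0⇒≡ (suc i) (suc j) (trans (sym (D′-hex-H i (suc j))) e))

  adj-old : ∀ {w v} → T (adj G w v) → T (adj G′ w v)
  adj-old = adj-spiroChain-mono s (n≤1+n m)

  D′-predecessor : ∀ {u v d} → u < size G′ → v < size G′ → D′ u v ≡ suc d →
                   ∃[ w ] w < size G′ × T (adj G′ w v) × D′ u w ≡ d
  D′-predecessor {u} {v} {d} u<′ v<′ e with vertex u<′ | vertex v<′
  ... | old u< | old v< with From.predecessor u< v< (trans (sym (D′-old-old u< v<)) e)
  ...   | w , w< , w~v , Duw≡ = w , old<′ w< , adj-old w~v , trans (D′-old-old u< w<) Duw≡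
  D′-predecessor {u} {v} {d} u<′ v<′ e | new i | old v< with toCut-step v<
  ...   | inj₁ refl = hexagon-predecessor {a = 0} {p = suc i} (D′-hex-H i) (λ ()) e
  ...   | inj₂ (w , w< , w~v , closer) = w , old<′ w< , adj-old w~v , suc-injective (begin
            suc (D′ u w)                       ≡⟨ cong suc (D′-hex-old i w<) ⟩
            suc (hexDist (suc i) zero + D w c) ≡⟨ sym (+-suc _ _) ⟩
            hexDist (suc i) zero + suc (D w c) ≡⟨ cong (hexDist (suc i) zero +_) closer ⟩
            hexDist (suc i) zero + D v c       ≡⟨ sym (D′-hex-old i v<) ⟩
            D′ u v                             ≡⟨ e ⟩
            suc d                              ∎)
    where open ≡-Reasoning
  D′-predecessor u<′ v<′ e | old u< | new j =
    hexagon-predecessor {p = zero} (D′-old-H u<) (λ ()) e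
  D′-predecessor u<′ v<′ e | new i | new j = hexagon-predecessor {a = 0} (D′-hex-H i) i≢j e
    where
    i≢j : suc i ≢ suc j
    i≢j refl = 0≢1+n (trans (sym (trans (D′-hex-H i (suc i)) (hexDist-self (suc i)))) e)

  D′-lipschitz : ∀ {u w v} → u < size G′ → T (adj G′ w v) → D′ u v ≤ suc (D′ u w)
  D′-lipschitz {u} {w} {v} u<′ w~v with adj-spiroChain-suc⁻ s {m} {w} {v} w~v | vertex u<′
  ... | inj₁ old-edge | old u< with adj⇒<size s {m} {w} {v} old-edge
  ...   | w< , v< rewrite D′-old-old u< v< | D′-old-old u< w< = From.lipschitz u< w< v< old-edge
  D′-lipschitz {u} {w} {v} u<′ w~v | inj₁ old-edge | new i with adj⇒<size s {m} {w} {v} old-edge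
  ...   | w< , v< rewrite D′-hex-old i v< | D′-hex-old i w< =
    ≤-trans (+-monoʳ-≤ (hexDist (suc i) zero) (toCut-lipschitz w< v< old-edge))
            (≤-reflexive (+-suc _ _))
  D′-lipschitz {u} {w} {v} u<′ w~v | inj₂ hex-edge | view with hexAdj⁻ s {m} {w} {v} hex-edge
  D′-lipschitz {u} u<′ w~v | inj₂ hex-edge | old u< | j , k , j~k , refl , refl =
    hexagon-lipschitz {a = D u c} {p = zero} (D′-old-H u<) j~k
  D′-lipschitz u<′ w~v | inj₂ hex-edge | new i  | j , k , j~k , refl , refl =
    hexagon-lipschitz {a = 0} {p = suc i} (D′-hex-H i) j~k

  D′-sym : ∀ {u v} → u < size G′ → v < size G′ → D′ u v ≡ D′ v u
  D′-sym {u} {v} u<′ v<′ with vertex u<′ | vertex v<′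
  ... | old u< | old v< rewrite D′-old-old u< v< | D′-old-old v< u< = dist-sym u< v<
  ... | old u< | new j  rewrite D′-old-H u< (suc j) | D′-hex-old j u< =
    trans (+-comm (D u c) _) (cong (_+ D u c) (hexDist-sym zero (suc j)))
  ... | new i  | old v< rewrite D′-old-H v< (suc i) | D′-hex-old i v< =
    trans (+-comm (hexDist (suc i) zero) _) (cong (D v c +_) (hexDist-sym (suc i) zero))
  ... | new i  | new j  rewrite D′-hex-H i (suc j) | D′-hex-H j (suc i) =
    hexDist-sym (suc i) (suc j)

  D′≤size : ∀ {u v} → u < size G′ → v < size G′ → D′ u v ≤ size G′
  D′≤size u<′ v<′ with vertex u<′ | vertex v<′
  ... | old u< | old v< rewrite D′-old-old u< v< =
    ≤-trans (dist≤size G _ _) (size-mono s (n≤1+n m))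
  ... | old u< | new j  rewrite D′-old-H u< (suc j) =
    +≤size′ (dist≤size G _ c) (hexDist≤3 zero (suc j))
  ... | new i  | old v< rewrite D′-hex-old i v< =
    subst (_≤ size G′) (+-comm (D _ c) _) (+≤size′ (dist≤size G _ c) (hexDist≤3 (suc i) zero))
  ... | new i  | new j  rewrite D′-hex-H i (suc j) = +≤size′ z≤n (hexDist≤3 (suc i) (suc j))

  isDistanceFrom′ : ∀ {u} → u < size G′ → IsDistanceFrom G′ u (D′ u)
  isDistanceFrom′ u<′ = record
    { source      = D′-source u<′
    ; zero⇒source = D′-zero⇒source u<′
    ; predecessor = D′-predecessor u<′
    ; lipschitz   = λ _ _ → D′-lipschitz u<′
    }

  dist′≡D′ : ∀ {u v} → u < size G′ → v < size G′ → dist G′ u v ≡ D′ u v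
  dist′≡D′ u<′ v<′ = dist≡ (isDistanceFrom′ u<′) v<′ (D′≤size u<′ v<′)

  distanceLaws′ : DistanceLaws G′
  distanceLaws′ = record
    { isDistanceFrom = λ u<′ →
        IsDistanceFrom-cong u<′ (λ v<′ → sym (dist′≡D′ u<′ v<′)) (isDistanceFrom′ u<′)
    ; dist-sym       = λ u<′ v<′ →
        trans (dist′≡D′ u<′ v<′) (trans (D′-sym u<′ v<′) (sym (dist′≡D′ v<′ u<′)))
    }

distanceLaws : ∀ s m → DistanceLaws (spiroChain s m)
distanceLaws s zero    = record
  { isDistanceFrom = λ { (s≤s z≤n) → record
    { source      = refl
    ; zero⇒source = λ { (s≤s z≤n) _ → refl }
    ; predecessor = λ { (s≤s z≤n) () }
    ; lipschitz   = λ _ _ ()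
    } }
  ; dist-sym       = λ { (s≤s z≤n) (s≤s z≤n) → refl }
  }
distanceLaws s (suc m) = Gluing.distanceLaws′ s m (distanceLaws s m)

-- Wiener indices

module Recurrences (s : ℕ → Fin 6) (m : ℕ) where
  open Gluing s m (distanceLaws s m)
  open ≡-Reasoning

  Wc : ℕ
  Wc = wienerAt G c

  sumUpTo-split : ∀ i f →
                  sumUpTo (N + suc i) f ≡ sumUpTo (size G) f + sumUpTo i (λ j → f (N + suc j))
  sumUpTo-split i f = begin
    sumUpTo (N + suc i) f                            ≡⟨ cong (λ n → sumUpTo n f) (sym (+-assoc N 1 i)) ⟩
    sumUpTo (size G + i) f                           ≡⟨ sumUpTo-+ (size G) i f ⟩
    sumUpTo (size G) f + sumUpTo i (λ j → f (size G + j))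
      ≡⟨ cong (sumUpTo (size G) f +_) (sumUpTo-cong i λ {j} _ → cong f (+-assoc N 1 j)) ⟩
    sumUpTo (size G) f + sumUpTo i (λ j → f (N + suc j)) ∎

  sumUpTo-G′ : ∀ f → sumUpTo (size G′) f ≡ sumUpTo (size G) f + sumUpTo 5 (λ i → f (N + suc i))
  sumUpTo-G′ f =
    trans (cong (λ n → sumUpTo n f) (trans (size-suc s m) (+-assoc N 1 5))) (sumUpTo-split 5 f)

  sum-toCut : ∀ x → sumUpTo (size G) (λ v → x + D v c) ≡ size G * x + Wc
  sum-toCut x = trans (sum-map-+ (λ _ → x) (λ v → D v c) (upTo (size G)))
                      (cong (_+ Wc) (sumUpTo-const (size G) x))

  dist-cut-H : ∀ q → dist G′ c (H q) ≡ hexDist zero q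
  dist-cut-H q = begin
    dist G′ c (H q)       ≡⟨ dist′≡D′ (old<′ c<) (H<′ q) ⟩
    D′ c (H q)            ≡⟨ D′-old-H c< q ⟩
    D c c + hexDist zero q ≡⟨ cong (_+ hexDist zero q) FromCut.source ⟩
    hexDist zero q        ∎

  wienerAt-H-sum : ∀ q → wienerAt G′ (H q)
               ≡ size G * hexDist zero q + Wc + sumUpTo 5 (λ i → hexDist (toPosition (suc i)) q)
  wienerAt-H-sum q = begin
    wienerAt G′ (H q)
      ≡⟨ sumUpTo-G′ (λ u → dist G′ u (H q)) ⟩
    sumUpTo (size G) (λ u → dist G′ u (H q)) + sumUpTo 5 (λ i → dist G′ (N + suc i) (H q))
      ≡⟨ cong₂ _+_ (sumUpTo-cong (size G) λ {u} u< → trans (dist′≡D′ (old<′ u<) (H<′ q))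
                                                (trans (D′-old-H u< q) (+-comm (D u c) _)))
                   (sumUpTo-cong 5 λ i<5 →
                     trans (dist′≡D′ (new<size s m i<5) (H<′ q)) (D′-new-H _ q)) ⟩
    sumUpTo (size G) (λ u → hexDist zero q + D u c) + sumUpTo 5 (λ i → hexDist (toPosition (suc i)) q)
      ≡⟨ cong (_+ _) (sum-toCut (hexDist zero q)) ⟩
    size G * hexDist zero q + Wc + sumUpTo 5 (λ i → hexDist (toPosition (suc i)) q) ∎

  wienerAt-H-recurrence : ∀ q → wienerAt G′ (H q) ≡ Wc + (5 * dist G′ c (H q) * m + 9)
  wienerAt-H-recurrence q = begin
    wienerAt G′ (H q)                  ≡⟨ wienerAt-H-sum q ⟩
    size G * h + Wc + R                ≡⟨ rearrange h Wc R m ⟩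
    Wc + (5 * h * m + (h + R))         ≡⟨ cong (λ x → Wc + (5 * h * m + x)) (wienerAt-hexagon q) ⟩
    Wc + (5 * h * m + 9)               ≡⟨ cong (λ x → Wc + (5 * x * m + 9)) (sym (dist-cut-H q)) ⟩
    Wc + (5 * dist G′ c (H q) * m + 9) ∎
    where
    h R : ℕ
    h = hexDist zero q
    R = sumUpTo 5 (λ i → hexDist (toPosition (suc i)) q)
    rearrange : ∀ h Wc R m → (5 * m + 1) * h + Wc + R ≡ Wc + (5 * h * m + (h + R))
    rearrange = solve-∀

  row-old : ∀ {u} → u < size G → sumUpTo u (dist G′ u) ≡ sumUpTo u (D u)
  row-old u< = sumUpTo-cong _ λ v<u → let v< = <-trans v<u u< in
    trans (dist′≡D′ (old<′ u<) (old<′ v<)) (D′-old-old u< v<)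

  row-new : ∀ {i} → i < 5 → sumUpTo (N + suc i) (dist G′ (N + suc i))
            ≡ size G * hexDist (toPosition (suc i)) zero + Wc
              + sumUpTo i (λ j → hexDist (toPosition (suc i)) (toPosition (suc j)))
  row-new {i} i<5 = begin
    sumUpTo (N + suc i) (dist G′ (N + suc i))
      ≡⟨ sumUpTo-split i _ ⟩
    sumUpTo (size G) (dist G′ (N + suc i)) + sumUpTo i (λ j → dist G′ (N + suc i) (N + suc j))
      ≡⟨ cong₂ _+_
           (sumUpTo-cong (size G) λ v< → trans (dist′≡D′ u<′ (old<′ v<)) (D′-new-old i v<))
           (sumUpTo-cong i λ j<i →
             trans (dist′≡D′ u<′ (new<size s m (<-trans j<i i<5))) (D′-new-new i _)) ⟩
    sumUpTo (size G) (λ v → hexDist (toPosition (suc i)) zero + D v c)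
      + sumUpTo i (λ j → hexDist (toPosition (suc i)) (toPosition (suc j)))
      ≡⟨ cong (_+ _) (sum-toCut _) ⟩
    size G * hexDist (toPosition (suc i)) zero + Wc
      + sumUpTo i (λ j → hexDist (toPosition (suc i)) (toPosition (suc j))) ∎
    where
    u<′ : N + suc i < size G′
    u<′ = new<size s m i<5

  wiener-recurrence : wiener G′ ≡ wiener G + 5 * Wc + (45 * suc m ∸ 18)
  wiener-recurrence = begin
    wiener G′
      ≡⟨ sumUpTo-G′ (λ u → sumUpTo u (dist G′ u)) ⟩
    sumUpTo (size G) (λ u → sumUpTo u (dist G′ u))
      + sumUpTo 5 (λ i → sumUpTo (N + suc i) (dist G′ (N + suc i)))
      ≡⟨ cong₂ _+_ (sumUpTo-cong (size G) row-old) (sumUpTo-cong 5 row-new) ⟩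
    wiener G + sumUpTo 5 (λ i → size G * x i + Wc + y i)
      ≡⟨ cong (wiener G +_) (begin
           sumUpTo 5 (λ i → size G * x i + Wc + y i)
             ≡⟨ sum-map-+ (λ i → size G * x i + Wc) y (upTo 5) ⟩
           sumUpTo 5 (λ i → size G * x i + Wc) + 18
             ≡⟨ cong (_+ 18) (sum-map-+ (λ i → size G * x i) (λ _ → Wc) (upTo 5)) ⟩
           sumUpTo 5 (λ i → size G * x i) + sumUpTo 5 (λ _ → Wc) + 18
             ≡⟨ cong₂ (λ a b → a + b + 18) (sum-map-*ˡ (size G) x (upTo 5)) (sumUpTo-const 5 Wc) ⟩
           size G * 9 + 5 * Wc + 18 ∎) ⟩
    wiener G + (size G * 9 + 5 * Wc + 18)
      ≡⟨ rearrange (wiener G) Wc m ⟩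
    wiener G + 5 * Wc + (27 + 45 * m)
      ≡⟨ cong (λ x → wiener G + 5 * Wc + (x ∸ 18)) (sym (*-suc 45 m)) ⟩
    wiener G + 5 * Wc + (45 * suc m ∸ 18) ∎
    where
    x y : ℕ → ℕ
    x i = hexDist (toPosition (suc i)) zero
    y i = sumUpTo i (λ j → hexDist (toPosition (suc i)) (toPosition (suc j)))
    rearrange : ∀ W Wc m → W + ((5 * m + 1) * 9 + 5 * Wc + 18) ≡ W + 5 * Wc + (27 + 45 * m)
    rearrange = solve-∀

wienerAt-recurrence : ∀ s m {d} → dist (spiroChain s (suc m)) (glob s m zero) (cut s (suc m)) ≡ d →
                      wienerAt (spiroChain s (suc m)) (cut s (suc m))
                      ≡ wienerAt (spiroChain s m) (glob s m zero) + (5 * d * m + 9)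
wienerAt-recurrence s m refl rewrite cut≡glob s m = Recurrences.wienerAt-H-recurrence s m (s m)

initial-values : ∀ s → wiener (spiroChain s 1) ≡ 27 × wienerAt (spiroChain s 1) (cut s 1) ≡ 9
initial-values s = Recurrences.wiener-recurrence s 0 ,
  trans (wienerAt-recurrence s 0 refl) (cong (_+ 9) (*-zeroʳ (5 * dist (spiroChain s 1) 0 (cut s 1))))

theorem2p1 :
    -- initial values (n = 1, c₁ any vertex of H₀)
    ((s : ℕ → Fin 6) →
        (wiener (spiroChain s 1) ≡ 27)
      × (wienerAt (spiroChain s 1) (cut s 1) ≡ 9))
    ×
    -- recurrences for n ≥ 2 (attachment data s, with c_{k+1} ≠ c_k)
    ((n : ℕ) → 2 ≤ n → (s : ℕ → Fin 6) →
      ((k : ℕ) → 1 ≤ k → k < n → s k ≢ zero) →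
        (wiener (spiroChain s n)
          ≡ wiener (spiroChain s (n ∸ 1))
            + 5 * wienerAt (spiroChain s (n ∸ 1)) (cut s (n ∸ 1))
            + (45 * n ∸ 18))
      × (dist (spiroChain s n) (cut s (n ∸ 1)) (cut s n) ≡ 1 →
          wienerAt (spiroChain s n) (cut s n)
            ≡ wienerAt (spiroChain s (n ∸ 1)) (cut s (n ∸ 1)) + (5 * (n ∸ 1) + 9))
      × (dist (spiroChain s n) (cut s (n ∸ 1)) (cut s n) ≡ 2 →
          wienerAt (spiroChain s n) (cut s n)
            ≡ wienerAt (spiroChain s (n ∸ 1)) (cut s (n ∸ 1)) + (10 * (n ∸ 1) + 9))
      × (dist (spiroChain s n) (cut s (n ∸ 1)) (cut s n) ≡ 3 →
          wienerAt (spiroChain s n) (cut s n)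
            ≡ wienerAt (spiroChain s (n ∸ 1)) (cut s (n ∸ 1)) + (15 * (n ∸ 1) + 9)))
-- The recurrences hold even when c_{k+1} = c_k.
theorem2p1 = initial-values , λ where
  (suc zero) (s≤s ())
  (suc (suc m)) _ s _ →
    Recurrences.wiener-recurrence s (suc m) ,
    wienerAt-recurrence s (suc m) , wienerAt-recurrence s (suc m) , wienerAt-recurrence s (suc m)
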